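{- For $n\ge 2$, the path $P_n$ on $n$ vertices satisfies $$\mathrm{ID}(P_n,x)=\sum_{k=1}^{\lfloor (n+3)/2\rfloor}\binom{k+1}{n-2k+1}x^k.$$
   Context: A set $W\subseteq V$ is an independent dominating set of a graph $G=(V,E)$ if every vertex of $V\setminus W$ is adjacent to at least one vertex of $W$ and no two vertices of $W$ are adjacent. The independent domination polynomial is $\mathrm{ID}(G,x)=\sum_{W}x^{|W|}$, the sum over all independent dominating sets $W$ of $G$. Binomial coefficients $\binom{a}{b}$ are taken to be $0$ when $b<0$ or $b>a$. -}

module Defs where

open import Data.Nat using (ℕ; zero; suc; _+_; _*_; _∸_; _/_; _≤ᵇ_; _≡ᵇ_)
open import Data.Nat.Combinatorics using (_C_)
open import Data.Bool using (Bool; true; false; _∧_; _∨_; not; if_then_else_)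
open import Data.Fin using (Fin; toℕ)
open import Data.Fin.Subset using (Subset; ∣_∣)
open import Data.Vec using (Vec; []; _∷_; lookup)
open import Data.List using (List; []; _∷_; map; _++_; length; filterᵇ)
open import Data.Bool.ListAction using (all; any)
open import Data.List using () renaming (allFin to allFinL)

-- A finite simple graph on vertex set Fin n, given by a Boolean adjacency
-- relation (assumed symmetric and irreflexive for the graphs we use).
record Graph (n : ℕ) : Set where
  field adj : Fin n → Fin n → Bool
open Graph public

pathGraph : (n : ℕ) → Graph n
pathGraph n = record { adj = λ i j → (suc (toℕ i) ≡ᵇ toℕ j) ∨ (suc (toℕ j) ≡ᵇ toℕ i) }

allSubsets : (n : ℕ) → List (Subset n)
allSubsets zero = [] ∷ []
allSubsets (suc n) = map (true ∷_) (allSubsets n) ++ map (false ∷_) (allSubsets n)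

isIndependent : ∀ {n} → Graph n → Subset n → Bool
isIndependent {n} G W =
  all (λ u → all (λ v → not (lookup W u ∧ lookup W v ∧ adj G u v)) (allFinL n)) (allFinL n)

isDominating : ∀ {n} → Graph n → Subset n → Bool
isDominating {n} G W =
  all (λ v → lookup W v ∨ any (λ u → lookup W u ∧ adj G u v) (allFinL n)) (allFinL n)

isIndependentDominating : ∀ {n} → Graph n → Subset n → Bool
isIndependentDominating G W = isIndependent G W ∧ isDominating G W

idCoeff : ∀ {n} → Graph n → ℕ → ℕ
idCoeff {n} G k =
  length (filterᵇ (λ W → isIndependentDominating G W ∧ (∣ W ∣ ≡ᵇ k)) (allSubsets n))

-- Coefficient of x^k in  Σ_{k=1}^{⌊(n+3)/2⌋} C(k+1, n-2k+1) x^k,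
-- with C(a,b) = 0 when b < 0 (i.e. when n + 1 < 2k) or b > a.
rhsCoeff : ℕ → ℕ → ℕ
rhsCoeff n k =
  if (1 ≤ᵇ k) ∧ (k ≤ᵇ ((n + 3) / 2)) ∧ (2 * k ≤ᵇ n + 1)
  then (suc k) C ((n + 1) ∸ 2 * k)
  else 0

module Submission where

-- A subset W of the vertices 0,…,n-1 of P_n is a bit string.  It is independent iff no
-- two consecutive bits are 1, and dominating iff every 0 has a neighbouring 1.  Both
-- conditions are local, so peeling off the first vertex (with one bit of memory about
-- the vertex before it) turns them into a three-state automaton reading W from left to
-- right.  Splitting the count of accepted strings with k ones on the first bit gives
-- mutual recurrences between the states, and these are solved by shifted binomial
-- coefficients C(a, m − j) via Pascal's rule: there are C(k+1, n+1−2k) independent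
-- dominating sets of size k.

open import Defs
open import Data.Nat using (ℕ; _≤_)
open import Relation.Binary.PropositionalEquality using (_≡_)

open import Function using (_∘_)
open import Data.Nat using (zero; suc; _+_; _*_; _∸_; _/_; _≤ᵇ_; _≡ᵇ_; s≤s; z≤n)
open import Data.Nat.Properties using (+-identityʳ; +-suc; +-comm; *-comm; ≤ᵇ⇒≤; ≤⇒≤ᵇ; <⇒≤; +-monoʳ-≤; module ≤-Reasoning)
open import Data.Nat.DivMod using (m*n/n≡m; /-monoˡ-≤)
open import Data.Nat.Combinatorics using (_C_; nCk+nC[k+1]≡[n+1]C[k+1]; k>n⇒nCk≡0)
open import Data.Bool using (Bool; true; false; _∧_; _∨_; not; if_then_else_; T)
open import Data.Bool.Properties using (∧-zeroʳ; ∧-identityʳ; ∨-identityʳ; ∧-comm; ∧-assoc; ∧-idem; ∧-commutativeMonoid)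
open import Data.Bool.ListAction using (all; any)
open import Data.Unit using (tt)
open import Data.Empty using (⊥-elim)
open import Data.Fin using (Fin) renaming (zero to fzero; suc to fsuc)
open import Data.Fin.Subset using (Subset; ∣_∣)
open import Data.Vec using (Vec; []; _∷_; lookup)
open import Data.List using ([]; _∷_; map; _++_; length; filterᵇ; tabulate)
open import Data.List.Properties using (filter-++; length-++)
open import Relation.Nullary.Decidable using (T?)
open import Relation.Binary.PropositionalEquality using (refl; sym; trans; cong; cong₂; module ≡-Reasoning)
open import Algebra.Bundles using (CommutativeMonoid)
open import Algebra.Properties.CommutativeSemigroup (CommutativeMonoid.commutativeSemigroup ∧-commutativeMonoid) using (interchange)

allF : ∀ n → (Fin n → Bool) → Bool
allF zero    q = true
allF (suc n) q = q fzero ∧ allF n (q ∘ fsuc)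

anyF : ∀ n → (Fin n → Bool) → Bool
anyF zero    q = false
anyF (suc n) q = q fzero ∨ anyF n (q ∘ fsuc)

all-tabulate : ∀ {A : Set} n (p : A → Bool) (f : Fin n → A) → all p (tabulate f) ≡ allF n (p ∘ f)
all-tabulate zero    p f = refl
all-tabulate (suc n) p f = cong (p (f fzero) ∧_) (all-tabulate n p (f ∘ fsuc))

any-tabulate : ∀ {A : Set} n (p : A → Bool) (f : Fin n → A) → any p (tabulate f) ≡ anyF n (p ∘ f)
any-tabulate zero    p f = refl
any-tabulate (suc n) p f = cong (p (f fzero) ∨_) (any-tabulate n p (f ∘ fsuc))

allF-cong : ∀ n {p q : Fin n → Bool} → (∀ i → p i ≡ q i) → allF n p ≡ allF n q
allF-cong zero    eq = refl
allF-cong (suc n) eq = cong₂ _∧_ (eq fzero) (allF-cong n (eq ∘ fsuc))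

allF-∧ : ∀ n (p q : Fin n → Bool) → allF n (λ i → p i ∧ q i) ≡ allF n p ∧ allF n q
allF-∧ zero    p q = refl
allF-∧ (suc n) p q = begin
  (p fzero ∧ q fzero) ∧ allF n (λ i → p (fsuc i) ∧ q (fsuc i))
    ≡⟨ cong ((p fzero ∧ q fzero) ∧_) (allF-∧ n (p ∘ fsuc) (q ∘ fsuc)) ⟩
  (p fzero ∧ q fzero) ∧ (allF n (p ∘ fsuc) ∧ allF n (q ∘ fsuc))
    ≡⟨ interchange (p fzero) (q fzero) _ _ ⟩
  (p fzero ∧ allF n (p ∘ fsuc)) ∧ (q fzero ∧ allF n (q ∘ fsuc)) ∎
  where open ≡-Reasoning

allF-head : ∀ n (q : Fin (suc n) → Bool) → (∀ i → q (fsuc i) ≡ true) → allF (suc n) q ≡ q fzero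
allF-head n q trivial = trans (cong (q fzero ∧_) (allTrue n (q ∘ fsuc) trivial)) (∧-identityʳ (q fzero))
  where
  allTrue : ∀ m (p : Fin m → Bool) → (∀ i → p i ≡ true) → allF m p ≡ true
  allTrue zero    p eq = refl
  allTrue (suc m) p eq = cong₂ _∧_ (eq fzero) (allTrue m (p ∘ fsuc) (eq ∘ fsuc))

anyF-head : ∀ n (q : Fin (suc n) → Bool) → (∀ i → q (fsuc i) ≡ false) → anyF (suc n) q ≡ q fzero
anyF-head n q trivial = trans (cong (q fzero ∨_) (anyFalse n (q ∘ fsuc) trivial)) (∨-identityʳ (q fzero))
  where
  anyFalse : ∀ m (p : Fin m → Bool) → (∀ i → p i ≡ false) → anyF m p ≡ false
  anyFalse zero    p eq = refl
  anyFalse (suc m) p eq = cong₂ _∨_ (eq fzero) (anyFalse m (p ∘ fsuc) (eq ∘ fsuc))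

-- Adjacency in P_n; it computes structurally: fsuc u ~ fsuc v iff u ~ v, vertex 0 is
-- adjacent only to vertex 1.
pathAdj : ∀ {n} → Fin n → Fin n → Bool
pathAdj {n} = adj (pathGraph n)

-- Whether the first vertex belongs to W (false if there is none).
firstIn : ∀ {n} → Vec Bool n → Bool
firstIn []      = false
firstIn (b ∷ _) = b

independent : ∀ n → Vec Bool n → Bool
independent n W = allF n (λ u → allF n (λ v → not (lookup W u ∧ lookup W v ∧ pathAdj u v)))

-- Domination of the vertices of W when W is the tail of the path c ∷ W: every vertex
-- of W lies in W or has a neighbour in c ∷ W.  The extra bit c is the vertex before W.
dominatedAfter : ∀ n → Bool → Vec Bool n → Bool
dominatedAfter n c W =
  allF n (λ v → lookup W v ∨ anyF (suc n) (λ u → lookup (c ∷ W) u ∧ pathAdj u (fsuc v)))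

isIndependent-path : ∀ n (W : Vec Bool n) → isIndependent (pathGraph n) W ≡ independent n W
isIndependent-path n W =
  trans (all-tabulate n _ (λ i → i)) (allF-cong n (λ u → all-tabulate n _ (λ i → i)))

isDominating-path : ∀ n (W : Vec Bool n) → isDominating (pathGraph n) W ≡ dominatedAfter n false W
isDominating-path n W =
  trans (all-tabulate n _ (λ i → i)) (allF-cong n (λ v → cong (lookup W v ∨_) (any-tabulate n _ (λ i → i))))

noEdge : ∀ x y → not (x ∧ y ∧ false) ≡ true
noEdge x y = cong not (trans (cong (x ∧_) (∧-zeroʳ y)) (∧-zeroʳ x))

frontConflictʳ : ∀ n b (W : Vec Bool n) →
  allF n (λ v → not (b ∧ lookup W v ∧ pathAdj fzero (fsuc v))) ≡ not (b ∧ firstIn W)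
frontConflictʳ zero    b []      = cong not (sym (∧-zeroʳ b))
frontConflictʳ (suc n) b (w ∷ W) =
  trans (allF-head n (λ v → not (b ∧ lookup (w ∷ W) v ∧ pathAdj fzero (fsuc v))) (λ i → noEdge b (lookup W i))) (cong (λ x → not (b ∧ x)) (∧-identityʳ w))

frontConflictˡ : ∀ n b (W : Vec Bool n) →
  allF n (λ u → not (lookup W u ∧ b ∧ pathAdj (fsuc u) fzero)) ≡ not (b ∧ firstIn W)
frontConflictˡ zero    b []      = cong not (sym (∧-zeroʳ b))
frontConflictˡ (suc n) b (w ∷ W) =
  trans (allF-head n (λ u → not (lookup (w ∷ W) u ∧ b ∧ pathAdj (fsuc u) fzero)) (λ i → noEdge (lookup W i) b))
        (cong not (trans (cong (w ∧_) (∧-identityʳ b)) (∧-comm w b)))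

frontDominated : ∀ n (W : Vec Bool n) →
  anyF n (λ u → lookup W u ∧ pathAdj (fsuc u) fzero) ≡ firstIn W
frontDominated zero    []      = refl
frontDominated (suc n) (w ∷ W) =
  trans (anyF-head n (λ u → lookup (w ∷ W) u ∧ pathAdj (fsuc u) fzero) (λ i → ∧-zeroʳ (lookup W i))) (∧-identityʳ w)

independent-cons : ∀ n b (W : Vec Bool n) →
  independent (suc n) (b ∷ W) ≡ not (b ∧ firstIn W) ∧ independent n W
independent-cons n b W = begin
  independent (suc n) (b ∷ W)
    ≡⟨ cong₂ _∧_ (cong₂ _∧_ (noEdge b b) (frontConflictʳ n b W)) (allF-∧ n _ _) ⟩
  free ∧ (allF n (λ u → not (lookup W u ∧ b ∧ pathAdj (fsuc u) fzero)) ∧ independent n W)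
    ≡⟨ cong (λ x → free ∧ (x ∧ independent n W)) (frontConflictˡ n b W) ⟩
  free ∧ (free ∧ independent n W)
    ≡⟨ sym (∧-assoc free free (independent n W)) ⟩
  (free ∧ free) ∧ independent n W
    ≡⟨ cong (_∧ independent n W) (∧-idem free) ⟩
  free ∧ independent n W ∎
  where
  open ≡-Reasoning
  free : Bool
  free = not (b ∧ firstIn W)

-- After c, the path b ∷ W is dominated iff b is dominated (by itself, c, or the next
-- vertex) and W is dominated after b: the vertex c is too far to reach into W.
dominatedAfter-cons : ∀ n c b (W : Vec Bool n) →
  dominatedAfter (suc n) c (b ∷ W) ≡ (b ∨ c ∨ firstIn W) ∧ dominatedAfter n b W
dominatedAfter-cons n c b W = cong₂ _∧_ frontVertex restOfPath
  where
  frontVertex : b ∨ ((c ∧ true) ∨ ((b ∧ false) ∨ anyF n (λ u → lookup W u ∧ pathAdj (fsuc u) fzero)))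
              ≡ b ∨ c ∨ firstIn W
  frontVertex = cong (b ∨_) (cong₂ _∨_ (∧-identityʳ c)
                  (trans (cong (_∨ _) (∧-zeroʳ b)) (frontDominated n W)))
  restOfPath : allF n (λ v → lookup W v ∨ ((c ∧ false) ∨ anyF (suc n) (λ u → lookup (b ∷ W) u ∧ pathAdj u (fsuc v))))
             ≡ dominatedAfter n b W
  restOfPath = allF-cong n (λ v → cong (λ x → lookup W v ∨ (x ∨ _)) (∧-zeroʳ c))

idsAfter : ∀ {n} → Bool → Vec Bool n → Bool
idsAfter {n} c W = independent n W ∧ dominatedAfter n c W

idsAfter-cons : ∀ {n} c b (W : Vec Bool n) →
  idsAfter c (b ∷ W) ≡ (not (b ∧ firstIn W) ∧ (b ∨ c ∨ firstIn W)) ∧ idsAfter b W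
idsAfter-cons {n} c b W =
  trans (cong₂ _∧_ (independent-cons n b W) (dominatedAfter-cons n c b W))
        (interchange (not (b ∧ firstIn W)) (independent n W) (b ∨ c ∨ firstIn W) (dominatedAfter n b W))

idsAfter-in : ∀ {n} c (W : Vec Bool n) → idsAfter c (true ∷ W) ≡ not (firstIn W) ∧ idsAfter true W
idsAfter-in c W = trans (idsAfter-cons c true W) (cong (_∧ idsAfter true W) (∧-identityʳ (not (firstIn W))))

-- The automaton reads W from left to right; its state describes the previous vertex:
-- in the set (afterIn), outside but dominated (afterDominated), or outside and not yet
-- dominated (afterUndominated).  A string is read from afterDominated: the absent vertex
-- before vertex 0 imposes nothing.
mutual
  afterIn : ∀ {n} → Vec Bool n → Bool
  afterIn []          = true
  afterIn (true ∷ W)  = false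
  afterIn (false ∷ W) = afterDominated W

  afterDominated : ∀ {n} → Vec Bool n → Bool
  afterDominated []          = true
  afterDominated (true ∷ W)  = afterIn W
  afterDominated (false ∷ W) = afterUndominated W

  afterUndominated : ∀ {n} → Vec Bool n → Bool
  afterUndominated []          = false
  afterUndominated (true ∷ W)  = afterIn W
  afterUndominated (false ∷ W) = false

mutual
  afterIn-correct : ∀ {n} (W : Vec Bool n) → afterIn W ≡ not (firstIn W) ∧ idsAfter true W
  afterIn-correct []          = refl
  afterIn-correct (true ∷ W)  = refl
  afterIn-correct (false ∷ W) = trans (afterDominated-correct W) (sym (idsAfter-cons true false W))

  afterDominated-correct : ∀ {n} (W : Vec Bool n) → afterDominated W ≡ idsAfter false W
  afterDominated-correct []          = refl
  afterDominated-correct (true ∷ W)  = trans (afterIn-correct W) (sym (idsAfter-in false W))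
  afterDominated-correct (false ∷ W) = trans (afterUndominated-correct W) (sym (idsAfter-cons false false W))

  afterUndominated-correct : ∀ {n} (W : Vec Bool n) → afterUndominated W ≡ firstIn W ∧ idsAfter false W
  afterUndominated-correct []          = refl
  afterUndominated-correct (true ∷ W)  = trans (afterIn-correct W) (sym (idsAfter-in false W))
  afterUndominated-correct (false ∷ W) = refl

isIndependentDominating-path : ∀ n (W : Subset n) →
  isIndependentDominating (pathGraph n) W ≡ afterDominated W
isIndependentDominating-path n W =
  trans (cong₂ _∧_ (isIndependent-path n W) (isDominating-path n W)) (sym (afterDominated-correct W))

module _ {A : Set} where

  length-filterᵇ-cong : ∀ (p q : A → Bool) → (∀ x → p x ≡ q x) → ∀ xs →
    length (filterᵇ p xs) ≡ length (filterᵇ q xs)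
  length-filterᵇ-cong p q eq []       = refl
  length-filterᵇ-cong p q eq (x ∷ xs) with p x | q x | eq x
  ... | true  | .true  | refl = cong suc (length-filterᵇ-cong p q eq xs)
  ... | false | .false | refl = length-filterᵇ-cong p q eq xs

  length-filterᵇ-none : ∀ (p : A → Bool) → (∀ x → p x ≡ false) → ∀ xs → length (filterᵇ p xs) ≡ 0
  length-filterᵇ-none p none []       = refl
  length-filterᵇ-none p none (x ∷ xs) with p x | none x
  ... | .false | refl = length-filterᵇ-none p none xs

length-filterᵇ-map : ∀ {A B : Set} (p : B → Bool) (f : A → B) xs →
  length (filterᵇ p (map f xs)) ≡ length (filterᵇ (p ∘ f) xs)
length-filterᵇ-map p f []       = refl
length-filterᵇ-map p f (x ∷ xs) with p (f x)
... | true  = cong suc (length-filterᵇ-map p f xs)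
... | false = length-filterᵇ-map p f xs

countOfSize : ∀ n → (Subset n → Bool) → ℕ → ℕ
countOfSize n p k = length (filterᵇ (λ W → p W ∧ (∣ W ∣ ≡ᵇ k)) (allSubsets n))

countOfSize-cong : ∀ n {p q : Subset n → Bool} → (∀ W → p W ≡ q W) → ∀ k → countOfSize n p k ≡ countOfSize n q k
countOfSize-cong n eq k = length-filterᵇ-cong _ _ (λ W → cong (_∧ (∣ W ∣ ≡ᵇ k)) (eq W)) (allSubsets n)

countOfSize-never : ∀ n (p : Subset n → Bool) k → (∀ W → p W ≡ false) → countOfSize n p k ≡ 0
countOfSize-never n p k never = length-filterᵇ-none _ (λ W → cong (_∧ (∣ W ∣ ≡ᵇ k)) (never W)) (allSubsets n)

countOfSize-split : ∀ n (p : Subset (suc n) → Bool) k → countOfSize (suc n) p k ≡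
  length (filterᵇ (λ W → p (true ∷ W) ∧ (suc ∣ W ∣ ≡ᵇ k)) (allSubsets n)) + countOfSize n (p ∘ (false ∷_)) k
countOfSize-split n p k = begin
  length (filterᵇ q (map (true ∷_) (allSubsets n) ++ map (false ∷_) (allSubsets n)))
    ≡⟨ cong length (filter-++ (T? ∘ q) (map (true ∷_) (allSubsets n)) _) ⟩
  length (filterᵇ q (map (true ∷_) (allSubsets n)) ++ filterᵇ q (map (false ∷_) (allSubsets n)))
    ≡⟨ length-++ (filterᵇ q (map (true ∷_) (allSubsets n))) ⟩
  length (filterᵇ q (map (true ∷_) (allSubsets n))) + length (filterᵇ q (map (false ∷_) (allSubsets n)))
    ≡⟨ cong₂ _+_ (length-filterᵇ-map q (true ∷_) (allSubsets n)) (length-filterᵇ-map q (false ∷_) (allSubsets n)) ⟩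
  length (filterᵇ (λ W → p (true ∷ W) ∧ (suc ∣ W ∣ ≡ᵇ k)) (allSubsets n)) + countOfSize n (p ∘ (false ∷_)) k ∎
  where
  open ≡-Reasoning
  q : Subset (suc n) → Bool
  q W = p W ∧ (∣ W ∣ ≡ᵇ k)

countOfSize-suc : ∀ n (p : Subset (suc n) → Bool) k →
  countOfSize (suc n) p (suc k) ≡ countOfSize n (p ∘ (true ∷_)) k + countOfSize n (p ∘ (false ∷_)) (suc k)
countOfSize-suc n p k = countOfSize-split n p (suc k)

-- The empty set avoids vertex 0.
countOfSize-zero : ∀ n (p : Subset (suc n) → Bool) →
  countOfSize (suc n) p zero ≡ countOfSize n (p ∘ (false ∷_)) zero
countOfSize-zero n p =
  trans (countOfSize-split n p zero)
        (cong (_+ countOfSize n (p ∘ (false ∷_)) zero) (length-filterᵇ-none _ (λ W → ∧-zeroʳ (p (true ∷ W))) (allSubsets n)))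

-- chooseMinus a m j = C(a, m − j), read as 0 when j > m.
chooseMinus : ℕ → ℕ → ℕ → ℕ
chooseMinus a m       zero    = a C m
chooseMinus a zero    (suc j) = 0
chooseMinus a (suc m) (suc j) = chooseMinus a m j

chooseMinus-pascal : ∀ a m j → chooseMinus (suc a) m j ≡ chooseMinus a m j + chooseMinus a m (suc j)
chooseMinus-pascal a zero    zero    = refl
chooseMinus-pascal a (suc m) zero    = trans (sym (nCk+nC[k+1]≡[n+1]C[k+1] a m)) (+-comm (a C m) (a C suc m))
chooseMinus-pascal a zero    (suc j) = refl
chooseMinus-pascal a (suc m) (suc j) = chooseMinus-pascal a m j

chooseMinus-explicit : ∀ a m j → chooseMinus a m j ≡ (if j ≤ᵇ m then a C (m ∸ j) else 0)
chooseMinus-explicit a m       zero          = refl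
chooseMinus-explicit a zero    (suc j)       = refl
chooseMinus-explicit a (suc m) (suc zero)    = chooseMinus-explicit a m zero
chooseMinus-explicit a (suc m) (suc (suc j)) = chooseMinus-explicit a m (suc j)

twice : ℕ → ℕ
twice zero    = 0
twice (suc k) = suc (suc (twice k))

twice≡2* : ∀ k → twice k ≡ 2 * k
twice≡2* zero    = refl
twice≡2* (suc k) = cong suc (trans (cong suc (twice≡2* k)) (sym (+-suc k (k + 0))))

mutual
  count-afterIn : ∀ n k → countOfSize n afterIn k ≡ chooseMinus (suc k) n (twice k)
  count-afterIn zero    zero    = refl
  count-afterIn zero    (suc k) = refl
  count-afterIn (suc n) zero    = trans (countOfSize-zero n afterIn) (count-afterDominated n zero)
  count-afterIn (suc n) (suc k) =
    trans (countOfSize-suc n afterIn k)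
          (cong₂ _+_ (countOfSize-never n _ k (λ W → refl)) (count-afterDominated n (suc k)))

  count-afterDominated : ∀ n k → countOfSize n afterDominated k ≡ chooseMinus (suc k) (suc n) (twice k)
  count-afterDominated zero    zero    = refl
  count-afterDominated zero    (suc k) = refl
  count-afterDominated (suc n) zero    = trans (countOfSize-zero n afterDominated) (count-afterUndominated n zero)
  count-afterDominated (suc n) (suc k) =
    trans (countOfSize-suc n afterDominated k)
          (trans (cong₂ _+_ (count-afterIn n k) (count-afterUndominated n (suc k)))
                 (sym (chooseMinus-pascal (suc k) n (twice k))))

  count-afterUndominated : ∀ n k → countOfSize n afterUndominated k ≡ chooseMinus k (suc n) (twice k)
  count-afterUndominated zero    zero    = refl
  count-afterUndominated zero    (suc k) = refl
  count-afterUndominated (suc n) zero    =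
    trans (countOfSize-zero n afterUndominated) (countOfSize-never n _ zero (λ W → refl))
  count-afterUndominated (suc n) (suc k) =
    trans (countOfSize-suc n afterUndominated k)
          (trans (cong₂ _+_ (count-afterIn n k) (countOfSize-never n _ (suc k) (λ W → refl)))
                 (+-identityʳ (chooseMinus (suc k) n (twice k))))

idCoeff-path : ∀ n k → idCoeff (pathGraph n) k ≡ chooseMinus (suc k) (suc n) (twice k)
idCoeff-path n k =
  trans (countOfSize-cong n (isIndependentDominating-path n) k) (count-afterDominated n k)

-- The summation limit ⌊(n+3)/2⌋ is implied by n+1−2k ≥ 0.
halfBound : ∀ n k → 2 * k ≤ n + 1 → k ≤ (n + 3) / 2
halfBound n k 2k≤n+1 = begin
  k             ≡⟨ sym (m*n/n≡m k 2) ⟩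
  k * 2 / 2     ≤⟨ /-monoˡ-≤ 2 (begin
                     k * 2 ≡⟨ *-comm k 2 ⟩
                     2 * k ≤⟨ 2k≤n+1 ⟩
                     n + 1 ≤⟨ +-monoʳ-≤ n (s≤s z≤n) ⟩
                     n + 3 ∎) ⟩
  (n + 3) / 2   ∎
  where open ≤-Reasoning

if-∧-implied : ∀ {A : Set} b₁ b₂ {x y : A} → (T b₂ → T b₁) →
  (if b₁ ∧ b₂ then x else y) ≡ (if b₂ then x else y)
if-∧-implied b₁    false _       = cong (if_then _ else _) (∧-zeroʳ b₁)
if-∧-implied true  true  _       = refl
if-∧-implied false true  implied = ⊥-elim (implied tt)

rhsCoeff-chooseMinus : ∀ n k → 1 ≤ n → rhsCoeff n k ≡ chooseMinus (suc k) (suc n) (twice k)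
rhsCoeff-chooseMinus n zero    1≤n = sym (k>n⇒nCk≡0 (s≤s 1≤n))
rhsCoeff-chooseMinus n (suc k) _   = begin
  rhsCoeff n (suc k)
    ≡⟨ if-∧-implied (suc k ≤ᵇ (n + 3) / 2) (2 * suc k ≤ᵇ n + 1)
         (≤⇒≤ᵇ ∘ halfBound n (suc k) ∘ ≤ᵇ⇒≤ (2 * suc k) (n + 1)) ⟩
  (if 2 * suc k ≤ᵇ n + 1 then suc (suc k) C (n + 1 ∸ 2 * suc k) else 0)
    ≡⟨ cong₂ (λ j m → if j ≤ᵇ m then suc (suc k) C (m ∸ j) else 0) (sym (twice≡2* (suc k))) (+-comm n 1) ⟩
  (if twice (suc k) ≤ᵇ suc n then suc (suc k) C (suc n ∸ twice (suc k)) else 0)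
    ≡⟨ sym (chooseMinus-explicit (suc (suc k)) (suc n) (twice (suc k))) ⟩
  chooseMinus (suc (suc k)) (suc n) (twice (suc k)) ∎
  where open ≡-Reasoning

mainTheorem19 : (n : ℕ) → 2 ≤ n → (k : ℕ) → idCoeff (pathGraph n) k ≡ rhsCoeff n k
mainTheorem19 n 2≤n k = trans (idCoeff-path n k) (sym (rhsCoeff-chooseMinus n k (<⇒≤ 2≤n)))
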